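{- Let $E: y^2=x^3+ax^2+bx$ ($a,b\in\mathbb{Z}$) be an elliptic curve and $P\in E(\mathbb{Q})$ a point of infinite order with $\gcd(m_0,b)=1$. Then $\gcd(m_k,b)=1$ for all $k\ge0$.
   Context: For $k\ge0$ write $2^kP=\left(\frac{m_k}{e_k^2},\frac{n_k}{e_k^3}\right)$ with $m_k,n_k,e_k\in\mathbb{Z}$, $e_k\ge1$, $\gcd(m_k,e_k)=\gcd(n_k,e_k)=1$. -}

module Defs where

open import Data.Nat as ℕ using (ℕ; suc; _^_)
open import Data.Integer as ℤ using (ℤ; +_)
open import Data.Integer.GCD as ℤG using ()
open import Data.Rational as ℚ using (ℚ; 0ℚ; 1ℚ; _+_; _*_; _-_; -_; 1/_; ≢-nonZero)
open import Data.Rational.Properties using (_≟_)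
open import Data.Product using (_×_)
open import Relation.Nullary using (¬_; yes; no)
open import Relation.Binary.PropositionalEquality using (_≡_; _≢_)

⟦_⟧ : ℤ → ℚ
⟦ z ⟧ = z ℚ./ 1

-- total inverse (only ever used on nonzero arguments below)
inv : ℚ → ℚ
inv p with p ≟ 0ℚ
... | yes _ = 0ℚ
... | no p≢0 = (1/ p) {{≢-nonZero p≢0}}

-- points of E(ℚ) ∪ {O} in affine coordinates: O is the point at infinity
data Pt : Set where
  O   : Pt
  aff : ℚ → ℚ → Pt

OnCurve : ℤ → ℤ → Pt → Set
OnCurve a b O = Data.Unit.⊤ where import Data.Unit
OnCurve a b (aff x y) = y * y ≡ x * x * x + ⟦ a ⟧ * (x * x) + ⟦ b ⟧ * x

-- E is an elliptic curve: discriminant 16 b² (a² − 4b) ≠ 0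
IsElliptic : ℤ → ℤ → Set
IsElliptic a b = ¬ (ℤ.+ 16 ℤ.* (b ℤ.* b) ℤ.* (a ℤ.* a ℤ.- ℤ.+ 4 ℤ.* b) ≡ ℤ.+ 0)

-- third point from slope λ through (x₁,y₁) and (x₂,·), reflected
chordPt : ℤ → ℚ → ℚ → ℚ → ℚ → Pt
chordPt a l x₁ y₁ x₂ = aff x₃ (- (l * (x₃ - x₁) + y₁))
  where x₃ = l * l - ⟦ a ⟧ - x₁ - x₂

add : ℤ → ℤ → Pt → Pt → Pt
add a b O Q = Q
add a b (aff x₁ y₁) O = aff x₁ y₁
add a b (aff x₁ y₁) (aff x₂ y₂) with x₁ ≟ x₂
... | no _ = chordPt a ((y₂ - y₁) * inv (x₂ - x₁)) x₁ y₁ x₂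
... | yes _ with y₁ ≟ - y₂
...   | yes _ = O
...   | no _  = chordPt a ((⟦ + 3 ⟧ * (x₁ * x₁) + ⟦ + 2 ⟧ * ⟦ a ⟧ * x₁ + ⟦ b ⟧)
                           * inv (⟦ + 2 ⟧ * y₁)) x₁ y₁ x₂

mul : ℤ → ℤ → ℕ → Pt → Pt
mul a b ℕ.zero P = O
mul a b (suc n) P = add a b P (mul a b n P)

InfiniteOrder : ℤ → ℤ → Pt → Set
InfiniteOrder a b P = ∀ (n : ℕ) → n ≢ 0 → mul a b n P ≢ O

Rep : Pt → ℤ → ℤ → ℤ → Set
Rep Q m e n =
  (ℤ.+ 1 ℤ.≤ e) × (ℤG.gcd m e ≡ ℤ.+ 1) × (ℤG.gcd n e ≡ ℤ.+ 1)
  × (Q ≡ aff (⟦ m ⟧ * inv ⟦ e ℤ.* e ⟧) (⟦ n ⟧ * inv ⟦ e ℤ.* e ℤ.* e ⟧))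

{-# OPTIONS --safe #-}
-- Fix a prime p ∣ b and let ℤ₍ₚ₎ ⊆ ℚ be the rationals with denominator prime to p. Since p ∣ b,
-- the reduction of E mod p is singular exactly at (0,0), and a point reduces there iff its
-- x-coordinate lies in pℤ₍ₚ₎ (for Q = (m/e², n/e³): iff p ∣ m). The remaining points, with O,
-- form the subgroup E₀ of points with nonsingular reduction; as multiples are iterated sums, only
-- closure of E₀ under the chord–tangent law is needed. Suppose the line of slope l meets E at
-- x₁, x₂, x₃ with x₃, hence y₃, in pℤ₍ₚ₎. Multiplying the second Vieta relation by s², with s = 1
-- if l ∈ ℤ₍ₚ₎ and s = 1/l ∈ pℤ₍ₚ₎ otherwise, gives s²x₁x₂ ∈ pℤ₍ₚ₎. For s = 1 this puts x₁ or x₂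
-- in pℤ₍ₚ₎; for s = 1/l it puts s²x₁ and s²x₂ there, contradicting s²x₁ + s²x₂ = 1 − s²(a + x₃).
module Submission where

open import Defs
open import Level using (0ℓ)
open import Data.Empty using (⊥; ⊥-elim)
open import Data.List using ([]; _∷_)
open import Data.List.Relation.Unary.All using (_∷_)
open import Data.Maybe.Base using (Maybe; just; nothing)
open import Data.Nat as ℕ using (ℕ; zero; suc; _^_)
import Data.Nat.GCD as ℕ
import Data.Nat.Coprimality as Coprimality
open import Data.Nat.Divisibility using (_∣_; _∣?_; _∣0; ∣-trans; ∣1⇒≡1; m∣m*n)
open import Data.Nat.Primality using (Prime; euclidsLemma; prime⇒nonTrivial; prime[2])
open import Data.Nat.Primality.Factorisation using (factorise)
open import Data.Integer as ℤ using (ℤ; +_; 1ℤ)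
import Data.Integer.Properties as ℤ
import Data.Integer.Divisibility.Signed as ℤ
open import Data.Integer.GCD using (gcd)
import Data.Integer.Tactic.RingSolver as ℤ-Solver
open import Data.Rational as ℚ using (ℚ; mkℚ; 0ℚ; 1ℚ; _+_; _*_; _-_; -_; ↥_; ↧_; ↧ₙ_)
import Data.Rational.Properties as ℚ
open import Algebra.Properties.Group ℚ.+-0-group using (x∙y⁻¹≈ε⇒x≈y; inverseˡ-unique)
open import Data.Rational.Unnormalised as ℚᵘ using (*≡*)
import Data.Rational.Unnormalised.Properties as ℚᵘ
open import Data.Product using (∃; _×_; _,_; proj₂)
open import Data.Sum as Sum using (_⊎_; inj₁; inj₂; [_,_]′)
open import Data.Unit using (tt)
open import Function using (id; _∘_)
open import Relation.Nullary using (¬_; yes; no)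
open import Relation.Binary.PropositionalEquality
import Tactic.RingSolver as RingSolver
import Tactic.RingSolver.Core.AlmostCommutativeRing as ACR
open ≡-Reasoning

ℚ-ring : ACR.AlmostCommutativeRing 0ℓ 0ℓ
ℚ-ring = ACR.fromCommutativeRing ℚ.+-*-commutativeRing 0≟
  where
  0≟ : ∀ x → Maybe (0ℚ ≡ x)
  0≟ x with x ℚ.≟ 0ℚ
  ... | yes x≡0 = just (sym x≡0)
  ... | no _    = nothing

⟦⟧≡mkℚ : ∀ z → ⟦ z ⟧ ≡ mkℚ z 0 (Coprimality.sym (Coprimality.1-coprimeTo ℤ.∣ z ∣))
⟦⟧≡mkℚ z = ℚ.↥p/↧p≡p (mkℚ z 0 _)

⟦⟧-* : ∀ m n → ⟦ m ℤ.* n ⟧ ≡ ⟦ m ⟧ * ⟦ n ⟧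
⟦⟧-* m n rewrite ⟦⟧≡mkℚ m | ⟦⟧≡mkℚ n = refl

⟦⟧-+ : ∀ m n → ⟦ m ℤ.+ n ⟧ ≡ ⟦ m ⟧ + ⟦ n ⟧
⟦⟧-+ m n rewrite ⟦⟧≡mkℚ m | ⟦⟧≡mkℚ n | ℤ.*-identityʳ m | ℤ.*-identityʳ n = refl

⟦⟧-neg : ∀ n → ⟦ ℤ.- n ⟧ ≡ - ⟦ n ⟧
⟦⟧-neg n = inverseˡ-unique ⟦ ℤ.- n ⟧ ⟦ n ⟧ (begin
  ⟦ ℤ.- n ⟧ + ⟦ n ⟧  ≡⟨ ⟦⟧-+ (ℤ.- n) n ⟨
  ⟦ ℤ.- n ℤ.+ n ⟧    ≡⟨ cong ⟦_⟧ (ℤ.+-inverseˡ n) ⟩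
  0ℚ                 ∎)

⟦⟧-injective : ∀ {m n} → ⟦ m ⟧ ≡ ⟦ n ⟧ → m ≡ n
⟦⟧-injective {m} {n} eq = begin
  m           ≡⟨ cong ↥_ (⟦⟧≡mkℚ m) ⟨
  ↥ ⟦ m ⟧     ≡⟨ cong ↥_ eq ⟩
  ↥ ⟦ n ⟧     ≡⟨ cong ↥_ (⟦⟧≡mkℚ n) ⟩
  n           ∎

*-↧≡↥ : ∀ q → q * ⟦ ↧ q ⟧ ≡ ⟦ ↥ q ⟧
*-↧≡↥ q@(mkℚ n d _) = ℚ.toℚᵘ-injective (ℚᵘ.≃-trans (ℚ.toℚᵘ-homo-* q ⟦ ↧ q ⟧) cleared)
  where
  cleared : ℚ.toℚᵘ q ℚᵘ.* ℚ.toℚᵘ ⟦ ↧ q ⟧ ℚᵘ.≃ ℚ.toℚᵘ ⟦ ↥ q ⟧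
  cleared rewrite ⟦⟧≡mkℚ (↧ q) | ⟦⟧≡mkℚ (↥ q) = *≡* (ℤ.*-assoc n (↧ q) 1ℤ)

*-rightComm : ∀ p q r → p * q * r ≡ p * r * q
*-rightComm = RingSolver.solve-∀ ℚ-ring

*-interchange : ∀ p q r s → p * q * (r * s) ≡ p * r * (q * s)
*-interchange = RingSolver.solve-∀ ℚ-ring

cross-multiply : ∀ {q} d n d′ n′ → q * ⟦ d ⟧ ≡ ⟦ n ⟧ → q * ⟦ d′ ⟧ ≡ ⟦ n′ ⟧ → n ℤ.* d′ ≡ n′ ℤ.* d
cross-multiply {q} d n d′ n′ eq eq′ = ⟦⟧-injective (begin
  ⟦ n ℤ.* d′ ⟧          ≡⟨ ⟦⟧-* n d′ ⟩
  ⟦ n ⟧ * ⟦ d′ ⟧        ≡⟨ cong (_* ⟦ d′ ⟧) eq ⟨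
  q * ⟦ d ⟧ * ⟦ d′ ⟧    ≡⟨ *-rightComm q ⟦ d ⟧ ⟦ d′ ⟧ ⟩
  q * ⟦ d′ ⟧ * ⟦ d ⟧    ≡⟨ cong (_* ⟦ d ⟧) eq′ ⟩
  ⟦ n′ ⟧ * ⟦ d ⟧        ≡⟨ ⟦⟧-* n′ d ⟨
  ⟦ n′ ℤ.* d ⟧          ∎)

inv-inverseˡ : ∀ {q} → q ≢ 0ℚ → inv q * q ≡ 1ℚ
inv-inverseˡ {q} q≢0 with q ℚ.≟ 0ℚ
... | yes q≡0 = ⊥-elim (q≢0 q≡0)
... | no q≢0′ = ℚ.*-inverseˡ q {{ℚ.≢-nonZero q≢0′}}

*-inv-cancel : ∀ q {r} → r ≢ 0ℚ → q * inv r * r ≡ q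
*-inv-cancel q {r} r≢0 = begin
  q * inv r * r    ≡⟨ ℚ.*-assoc q (inv r) r ⟩
  q * (inv r * r)  ≡⟨ cong (q *_) (inv-inverseˡ r≢0) ⟩
  q * 1ℚ           ≡⟨ ℚ.*-identityʳ q ⟩
  q                ∎

*≡0⇒≡0 : ∀ q r → q * r ≡ 0ℚ → q ≡ 0ℚ ⊎ r ≡ 0ℚ
*≡0⇒≡0 q r qr≡0 with q ℚ.≟ 0ℚ
... | yes q≡0 = inj₁ q≡0
... | no q≢0  = inj₂ (begin
  r              ≡⟨ *-inv-cancel r q≢0 ⟨
  r * inv q * q  ≡⟨ swap r (inv q) q ⟩
  q * r * inv q  ≡⟨ cong (_* inv q) qr≡0 ⟩
  0ℚ * inv q     ≡⟨ ℚ.*-zeroˡ (inv q) ⟩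
  0ℚ             ∎)
  where
  swap : ∀ r s q → r * s * q ≡ q * r * s
  swap = RingSolver.solve-∀ ℚ-ring

⟦e*e⟧≢0 : ∀ {e} → + 1 ℤ.≤ e → ⟦ e ℤ.* e ⟧ ≢ 0ℚ
⟦e*e⟧≢0 {+ suc k} (ℤ.+≤+ (ℕ.s≤s _)) e*e≡0 with ⟦⟧-injective {+ suc k ℤ.* + suc k} {+ 0} e*e≡0
... | ()

module Localisation {p : ℕ} (p-prime : Prime p) where

  p≢1 : p ≢ 1
  p≢1 = ℕ.nonTrivial⇒≢1 {{prime⇒nonTrivial p-prime}}

  p∤1 : ¬ p ∣ 1
  p∤1 = p≢1 ∘ ∣1⇒≡1

  p∣*-cancelʳ : ∀ m n → ¬ p ∣ ℤ.∣ n ∣ → p ∣ ℤ.∣ m ℤ.* n ∣ → p ∣ ℤ.∣ m ∣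
  p∣*-cancelʳ m n p∤n p∣mn with euclidsLemma _ _ p-prime (subst (p ∣_) (ℤ.abs-* m n) p∣mn)
  ... | inj₁ p∣m = p∣m
  ... | inj₂ p∣n = ⊥-elim (p∤n p∣n)

  p∤* : ∀ m n → ¬ p ∣ ℤ.∣ m ∣ → ¬ p ∣ ℤ.∣ n ∣ → ¬ p ∣ ℤ.∣ m ℤ.* n ∣
  p∤* m n p∤m p∤n = p∤m ∘ p∣*-cancelʳ m n p∤n

  coprime⇒¬p∣both : ∀ m n → gcd m n ≡ + 1 → p ∣ ℤ.∣ m ∣ → ¬ p ∣ ℤ.∣ n ∣
  coprime⇒¬p∣both m n gcd≡1 p∣m p∣n = p∤1 (subst (p ∣_) (ℤ.+-injective gcd≡1) (ℕ.gcd-greatest p∣m p∣n))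

  p∣↥⇒p∤↧ : ∀ q → p ∣ ℤ.∣ ↥ q ∣ → ¬ p ∣ ↧ₙ q
  p∣↥⇒p∤↧ (mkℚ _ _ coprime) p∣↥ p∣↧ = p≢1 (Coprimality.recompute coprime (p∣↥ , p∣↧))

  infix 4 _∈_·ℤ₍ₚ₎ _∈ℤ₍ₚ₎ _∈pℤ₍ₚ₎

  -- x = c·n/d with p ∤ d, i.e. x lies in the ideal c·ℤ₍ₚ₎ of the localisation of ℤ at p.
  record _∈_·ℤ₍ₚ₎ (x : ℚ) (c : ℤ) : Set where
    constructor fraction
    field
      numerator denominator : ℤ
      p∤denominator : ¬ p ∣ ℤ.∣ denominator ∣
      cleared : x * ⟦ denominator ⟧ ≡ ⟦ c ℤ.* numerator ⟧

  _∈ℤ₍ₚ₎ : ℚ → Set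
  x ∈ℤ₍ₚ₎ = x ∈ 1ℤ ·ℤ₍ₚ₎

  _∈pℤ₍ₚ₎ : ℚ → Set
  x ∈pℤ₍ₚ₎ = x ∈ + p ·ℤ₍ₚ₎

  ·ℤ₍ₚ₎-+ : ∀ {x y c} → x ∈ c ·ℤ₍ₚ₎ → y ∈ c ·ℤ₍ₚ₎ → x + y ∈ c ·ℤ₍ₚ₎
  ·ℤ₍ₚ₎-+ {x} {y} {c} (fraction n d p∤d xd≡cn) (fraction n′ d′ p∤d′ yd′≡cn′) =
    fraction (n ℤ.* d′ ℤ.+ n′ ℤ.* d) (d ℤ.* d′) (p∤* d d′ p∤d p∤d′) (begin
      (x + y) * ⟦ d ℤ.* d′ ⟧                       ≡⟨ cong ((x + y) *_) (⟦⟧-* d d′) ⟩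
      (x + y) * (⟦ d ⟧ * ⟦ d′ ⟧)                   ≡⟨ distribute x y ⟦ d ⟧ ⟦ d′ ⟧ ⟩
      x * ⟦ d ⟧ * ⟦ d′ ⟧ + y * ⟦ d′ ⟧ * ⟦ d ⟧      ≡⟨ cong₂ (λ u v → u * ⟦ d′ ⟧ + v * ⟦ d ⟧) xd≡cn yd′≡cn′ ⟩
      ⟦ c ℤ.* n ⟧ * ⟦ d′ ⟧ + ⟦ c ℤ.* n′ ⟧ * ⟦ d ⟧  ≡⟨ cong₂ _+_ (⟦⟧-* (c ℤ.* n) d′) (⟦⟧-* (c ℤ.* n′) d) ⟨
      ⟦ c ℤ.* n ℤ.* d′ ⟧ + ⟦ c ℤ.* n′ ℤ.* d ⟧      ≡⟨ ⟦⟧-+ (c ℤ.* n ℤ.* d′) (c ℤ.* n′ ℤ.* d) ⟨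
      ⟦ c ℤ.* n ℤ.* d′ ℤ.+ c ℤ.* n′ ℤ.* d ⟧        ≡⟨ cong ⟦_⟧ (factor c n d′ n′ d) ⟩
      ⟦ c ℤ.* (n ℤ.* d′ ℤ.+ n′ ℤ.* d) ⟧            ∎)
    where
    distribute : ∀ x y d d′ → (x + y) * (d * d′) ≡ x * d * d′ + y * d′ * d
    distribute = RingSolver.solve-∀ ℚ-ring
    factor : ∀ c n d′ n′ d → c ℤ.* n ℤ.* d′ ℤ.+ c ℤ.* n′ ℤ.* d ≡ c ℤ.* (n ℤ.* d′ ℤ.+ n′ ℤ.* d)
    factor = ℤ-Solver.solve-∀

  ·ℤ₍ₚ₎-* : ∀ {x y c c′} → x ∈ c ·ℤ₍ₚ₎ → y ∈ c′ ·ℤ₍ₚ₎ → x * y ∈ c ℤ.* c′ ·ℤ₍ₚ₎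
  ·ℤ₍ₚ₎-* {x} {y} {c} {c′} (fraction n d p∤d xd≡cn) (fraction n′ d′ p∤d′ yd′≡cn′) =
    fraction (n ℤ.* n′) (d ℤ.* d′) (p∤* d d′ p∤d p∤d′) (begin
      x * y * ⟦ d ℤ.* d′ ⟧                ≡⟨ cong (x * y *_) (⟦⟧-* d d′) ⟩
      x * y * (⟦ d ⟧ * ⟦ d′ ⟧)            ≡⟨ *-interchange x y ⟦ d ⟧ ⟦ d′ ⟧ ⟩
      x * ⟦ d ⟧ * (y * ⟦ d′ ⟧)            ≡⟨ cong₂ _*_ xd≡cn yd′≡cn′ ⟩
      ⟦ c ℤ.* n ⟧ * ⟦ c′ ℤ.* n′ ⟧         ≡⟨ ⟦⟧-* (c ℤ.* n) (c′ ℤ.* n′) ⟨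
      ⟦ c ℤ.* n ℤ.* (c′ ℤ.* n′) ⟧         ≡⟨ cong ⟦_⟧ (regroup c n c′ n′) ⟩
      ⟦ c ℤ.* c′ ℤ.* (n ℤ.* n′) ⟧         ∎)
    where
    regroup : ∀ c n c′ n′ → c ℤ.* n ℤ.* (c′ ℤ.* n′) ≡ c ℤ.* c′ ℤ.* (n ℤ.* n′)
    regroup = ℤ-Solver.solve-∀

  ·ℤ₍ₚ₎-neg : ∀ {x c} → x ∈ c ·ℤ₍ₚ₎ → - x ∈ c ·ℤ₍ₚ₎
  ·ℤ₍ₚ₎-neg {x} {c} (fraction n d p∤d xd≡cn) = fraction (ℤ.- n) d p∤d (begin
    - x * ⟦ d ⟧            ≡⟨ ℚ.neg-distribˡ-* x ⟦ d ⟧ ⟨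
    - (x * ⟦ d ⟧)          ≡⟨ cong -_ xd≡cn ⟩
    - ⟦ c ℤ.* n ⟧          ≡⟨ ⟦⟧-neg (c ℤ.* n) ⟨
    ⟦ ℤ.- (c ℤ.* n) ⟧      ≡⟨ cong ⟦_⟧ (ℤ.neg-distribʳ-* c n) ⟩
    ⟦ c ℤ.* ℤ.- n ⟧        ∎)

  ·ℤ₍ₚ₎-- : ∀ {x y c} → x ∈ c ·ℤ₍ₚ₎ → y ∈ c ·ℤ₍ₚ₎ → x - y ∈ c ·ℤ₍ₚ₎
  ·ℤ₍ₚ₎-- x∈ y∈ = ·ℤ₍ₚ₎-+ x∈ (·ℤ₍ₚ₎-neg y∈)

  ·ℤ₍ₚ₎-cong : ∀ {x c c′} → c ≡ c′ → x ∈ c ·ℤ₍ₚ₎ → x ∈ c′ ·ℤ₍ₚ₎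
  ·ℤ₍ₚ₎-cong refl x∈ = x∈

  ∈pℤ₍ₚ₎-cong : ∀ {x y} → x ≡ y → x ∈pℤ₍ₚ₎ → y ∈pℤ₍ₚ₎
  ∈pℤ₍ₚ₎-cong = subst _∈pℤ₍ₚ₎

  ·ℤ₍ₚ₎⊆ℤ₍ₚ₎ : ∀ {x c} → x ∈ c ·ℤ₍ₚ₎ → x ∈ℤ₍ₚ₎
  ·ℤ₍ₚ₎⊆ℤ₍ₚ₎ {c = c} (fraction n d p∤d xd≡cn) =
    fraction (c ℤ.* n) d p∤d (trans xd≡cn (cong ⟦_⟧ (sym (ℤ.*-identityˡ (c ℤ.* n)))))

  ∈ℤ₍ₚ₎-* : ∀ {x y} → x ∈ℤ₍ₚ₎ → y ∈ℤ₍ₚ₎ → x * y ∈ℤ₍ₚ₎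
  ∈ℤ₍ₚ₎-* = ·ℤ₍ₚ₎-*

  ∈pℤ₍ₚ₎-*ˡ : ∀ {r x} → r ∈ℤ₍ₚ₎ → x ∈pℤ₍ₚ₎ → r * x ∈pℤ₍ₚ₎
  ∈pℤ₍ₚ₎-*ˡ r∈ x∈ = ·ℤ₍ₚ₎-cong (ℤ.*-identityˡ (+ p)) (·ℤ₍ₚ₎-* r∈ x∈)

  ∈pℤ₍ₚ₎-*ʳ : ∀ {x r} → x ∈pℤ₍ₚ₎ → r ∈ℤ₍ₚ₎ → x * r ∈pℤ₍ₚ₎
  ∈pℤ₍ₚ₎-*ʳ x∈ r∈ = ·ℤ₍ₚ₎-cong (ℤ.*-identityʳ (+ p)) (·ℤ₍ₚ₎-* x∈ r∈)

  ∈ℤ₍ₚ₎-intro : ∀ {x} d n → ¬ p ∣ ℤ.∣ d ∣ → x * ⟦ d ⟧ ≡ ⟦ n ⟧ → x ∈ℤ₍ₚ₎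
  ∈ℤ₍ₚ₎-intro d n p∤d xd≡n = fraction n d p∤d (trans xd≡n (cong ⟦_⟧ (sym (ℤ.*-identityˡ n))))

  ⟦⟧∈ℤ₍ₚ₎ : ∀ n → ⟦ n ⟧ ∈ℤ₍ₚ₎
  ⟦⟧∈ℤ₍ₚ₎ n = ∈ℤ₍ₚ₎-intro 1ℤ n p∤1 (ℚ.*-identityʳ ⟦ n ⟧)

  ∈pℤ₍ₚ₎-intro : ∀ {x} d n → ¬ p ∣ ℤ.∣ d ∣ → x * ⟦ d ⟧ ≡ ⟦ n ⟧ → p ∣ ℤ.∣ n ∣ → x ∈pℤ₍ₚ₎
  ∈pℤ₍ₚ₎-intro d n p∤d xd≡n p∣n with ℤ.∣ᵤ⇒∣ {+ p} {n} p∣n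
  ... | ℤ.divides k n≡kp = fraction k d p∤d (trans xd≡n (cong ⟦_⟧ (trans n≡kp (ℤ.*-comm k (+ p)))))

  ∈pℤ₍ₚ₎⇒p∣ : ∀ {x} d n → x ∈pℤ₍ₚ₎ → x * ⟦ d ⟧ ≡ ⟦ n ⟧ → p ∣ ℤ.∣ n ∣
  ∈pℤ₍ₚ₎⇒p∣ {x} d n (fraction k d′ p∤d′ xd′≡pk) xd≡n =
    p∣*-cancelʳ n d′ p∤d′ (ℤ.∣⇒∣ᵤ (ℤ.divides (k ℤ.* d) (begin
      n ℤ.* d′           ≡⟨ cross-multiply {x} d n d′ (+ p ℤ.* k) xd≡n xd′≡pk ⟩
      + p ℤ.* k ℤ.* d    ≡⟨ rotate (+ p) k d ⟩
      k ℤ.* d ℤ.* + p    ∎)))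
    where
    rotate : ∀ p k d → p ℤ.* k ℤ.* d ≡ k ℤ.* d ℤ.* p
    rotate = ℤ-Solver.solve-∀

  1∉pℤ₍ₚ₎ : ¬ 1ℚ ∈pℤ₍ₚ₎
  1∉pℤ₍ₚ₎ 1∈ = p∤1 (∈pℤ₍ₚ₎⇒p∣ 1ℤ 1ℤ 1∈ refl)

  p∣↥⇒∈pℤ₍ₚ₎ : ∀ x → p ∣ ℤ.∣ ↥ x ∣ → x ∈pℤ₍ₚ₎
  p∣↥⇒∈pℤ₍ₚ₎ x p∣↥ = ∈pℤ₍ₚ₎-intro (↧ x) (↥ x) (p∣↥⇒p∤↧ x p∣↥) (*-↧≡↥ x) p∣↥

  pℤ₍ₚ₎-prime : ∀ x y → x * y ∈pℤ₍ₚ₎ → x ∈pℤ₍ₚ₎ ⊎ y ∈pℤ₍ₚ₎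
  pℤ₍ₚ₎-prime x y xy∈ =
    Sum.map (p∣↥⇒∈pℤ₍ₚ₎ x) (p∣↥⇒∈pℤ₍ₚ₎ y) (euclidsLemma ℤ.∣ ↥ x ∣ ℤ.∣ ↥ y ∣ p-prime p∣↥x↥y)
    where
    cleared : x * y * ⟦ ↧ x ℤ.* ↧ y ⟧ ≡ ⟦ ↥ x ℤ.* ↥ y ⟧
    cleared = begin
      x * y * ⟦ ↧ x ℤ.* ↧ y ⟧        ≡⟨ cong (x * y *_) (⟦⟧-* (↧ x) (↧ y)) ⟩
      x * y * (⟦ ↧ x ⟧ * ⟦ ↧ y ⟧)    ≡⟨ *-interchange x y ⟦ ↧ x ⟧ ⟦ ↧ y ⟧ ⟩
      x * ⟦ ↧ x ⟧ * (y * ⟦ ↧ y ⟧)    ≡⟨ cong₂ _*_ (*-↧≡↥ x) (*-↧≡↥ y) ⟩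
      ⟦ ↥ x ⟧ * ⟦ ↥ y ⟧              ≡⟨ ⟦⟧-* (↥ x) (↥ y) ⟨
      ⟦ ↥ x ℤ.* ↥ y ⟧                ∎
    p∣↥x↥y : p ∣ ℤ.∣ ↥ x ∣ ℕ.* ℤ.∣ ↥ y ∣
    p∣↥x↥y = subst (p ∣_) (ℤ.abs-* (↥ x) (↥ y)) (∈pℤ₍ₚ₎⇒p∣ (↧ x ℤ.* ↧ y) (↥ x ℤ.* ↥ y) xy∈ cleared)

  -- ℤ₍ₚ₎ is a valuation ring.
  ∈ℤ₍ₚ₎⊎inverse∈pℤ₍ₚ₎ : ∀ x → x ∈ℤ₍ₚ₎ ⊎ ∃ λ s → s ∈pℤ₍ₚ₎ × s * x ≡ 1ℚ
  ∈ℤ₍ₚ₎⊎inverse∈pℤ₍ₚ₎ x with p ∣? ↧ₙ x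
  ... | no p∤↧ = inj₁ (∈ℤ₍ₚ₎-intro (↧ x) (↥ x) p∤↧ (*-↧≡↥ x))
  ... | yes p∣↧ =
    inj₂ (inv x , ∈pℤ₍ₚ₎-intro (↥ x) (↧ x) (λ p∣↥ → p∣↥⇒p∤↧ x p∣↥ p∣↧) cleared p∣↧ , inv-inverseˡ x≢0)
    where
    x≢0 : x ≢ 0ℚ
    x≢0 x≡0 = p∤1 (subst (λ y → p ∣ ↧ₙ y) x≡0 p∣↧)
    cleared : inv x * ⟦ ↥ x ⟧ ≡ ⟦ ↧ x ⟧
    cleared = begin
      inv x * ⟦ ↥ x ⟧          ≡⟨ cong (inv x *_) (*-↧≡↥ x) ⟨
      inv x * (x * ⟦ ↧ x ⟧)    ≡⟨ ℚ.*-assoc (inv x) x ⟦ ↧ x ⟧ ⟨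
      inv x * x * ⟦ ↧ x ⟧      ≡⟨ cong (_* ⟦ ↧ x ⟧) (inv-inverseˡ x≢0) ⟩
      1ℚ * ⟦ ↧ x ⟧             ≡⟨ ℚ.*-identityˡ ⟦ ↧ x ⟧ ⟩
      ⟦ ↧ x ⟧                  ∎

module ChordTangent (a b : ℤ) where

  f : ℚ → ℚ
  f x = x * x * x + ⟦ a ⟧ * (x * x) + ⟦ b ⟧ * x

  chordX : ℚ → ℚ → ℚ → ℚ
  chordX l x₁ x₂ = l * l - ⟦ a ⟧ - x₁ - x₂

  line : ℚ → ℚ → ℚ → ℚ → ℚ
  line l x₁ y₁ x = l * (x - x₁) + y₁

  -- σ₂ is the second elementary symmetric function of x₁, x₂, chordX and c₁ the x-coefficient of
  -- f − line²; the x² coefficients of f − line² and (x − x₁)(x − x₂)(x − chordX) agree by the choice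
  -- of chordX, so a Chord says that x₁, x₂ and chordX are the roots of f − line².
  σ₂ : ℚ → ℚ → ℚ → ℚ
  σ₂ l x₁ x₂ = x₁ * x₂ + (x₁ + x₂) * chordX l x₁ x₂

  c₁ : ℚ → ℚ → ℚ → ℚ
  c₁ l x₁ y₁ = ⟦ b ⟧ - ⟦ + 2 ⟧ * l * (y₁ - l * x₁)

  record Chord (l x₁ y₁ x₂ : ℚ) : Set where
    field
      on-curve : y₁ * y₁ ≡ f x₁
      vieta    : σ₂ l x₁ x₂ ≡ c₁ l x₁ y₁

  residual-linear : ∀ l x₁ y₁ x₂ x →
    f x - line l x₁ y₁ x * line l x₁ y₁ x ≡
    (x - x₁) * (x - x₂) * (x - chordX l x₁ x₂) + (f x₁ - y₁ * y₁) + (c₁ l x₁ y₁ - σ₂ l x₁ x₂) * (x - x₁)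
  residual-linear = identity ⟦ a ⟧ ⟦ b ⟧
    where
    identity : ∀ A B l x₁ y₁ x₂ x →
      x * x * x + A * (x * x) + B * x - (l * (x - x₁) + y₁) * (l * (x - x₁) + y₁) ≡
      (x - x₁) * (x - x₂) * (x - (l * l - A - x₁ - x₂)) + (x₁ * x₁ * x₁ + A * (x₁ * x₁) + B * x₁ - y₁ * y₁)
      + (B - ⟦ + 2 ⟧ * l * (y₁ - l * x₁) - (x₁ * x₂ + (x₁ + x₂) * (l * l - A - x₁ - x₂))) * (x - x₁)
    identity = RingSolver.solve-∀ ℚ-ring

  residual-at-root : ∀ l x₁ y₁ x₂ x → (x - x₁) * (x - x₂) * (x - chordX l x₁ x₂) ≡ 0ℚ →
    f x - line l x₁ y₁ x * line l x₁ y₁ x ≡ (f x₁ - y₁ * y₁) + (c₁ l x₁ y₁ - σ₂ l x₁ x₂) * (x - x₁)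
  residual-at-root l x₁ y₁ x₂ x cubic≡0 = begin
    f x - line l x₁ y₁ x * line l x₁ y₁ x                          ≡⟨ residual-linear l x₁ y₁ x₂ x ⟩
    (x - x₁) * (x - x₂) * (x - chordX l x₁ x₂) + r + d * (x - x₁)  ≡⟨ cong (λ t → t + r + d * (x - x₁)) cubic≡0 ⟩
    0ℚ + r + d * (x - x₁)                                          ≡⟨ cong (_+ d * (x - x₁)) (ℚ.+-identityˡ r) ⟩
    r + d * (x - x₁)                                               ∎
    where
    r = f x₁ - y₁ * y₁
    d = c₁ l x₁ y₁ - σ₂ l x₁ x₂

  on-curve⇒f-y²≡0 : ∀ x y → y * y ≡ f x → f x - y * y ≡ 0ℚ
  on-curve⇒f-y²≡0 x y on = trans (cong (λ t → f x - t) on) (ℚ.+-inverseʳ (f x))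

  Chord⇒on-curve : ∀ {l x₁ y₁ x₂} → Chord l x₁ y₁ x₂ → OnCurve a b (chordPt a l x₁ y₁ x₂)
  Chord⇒on-curve {l} {x₁} {y₁} {x₂} c = begin
    - L * - L      ≡⟨ neg-square L ⟩
    L * L          ≡⟨ x∙y⁻¹≈ε⇒x≈y (f x₃) (L * L) residual≡0 ⟨
    f x₃           ∎
    where
    open Chord c
    x₃ = chordX l x₁ x₂
    L = line l x₁ y₁ x₃
    neg-square : ∀ y → - y * - y ≡ y * y
    neg-square = RingSolver.solve-∀ ℚ-ring
    cubic-root : ∀ u v w → u * v * (w - w) ≡ 0ℚ
    cubic-root = RingSolver.solve-∀ ℚ-ring
    defect≡0 : c₁ l x₁ y₁ - σ₂ l x₁ x₂ ≡ 0ℚ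
    defect≡0 = trans (cong (λ t → c₁ l x₁ y₁ - t) vieta) (ℚ.+-inverseʳ (c₁ l x₁ y₁))
    residual≡0 : f x₃ - L * L ≡ 0ℚ
    residual≡0 = begin
      f x₃ - L * L                                              ≡⟨ residual-at-root l x₁ y₁ x₂ x₃ (cubic-root (x₃ - x₁) (x₃ - x₂) x₃) ⟩
      (f x₁ - y₁ * y₁) + (c₁ l x₁ y₁ - σ₂ l x₁ x₂) * (x₃ - x₁)  ≡⟨ cong₂ (λ r d → r + d * (x₃ - x₁)) (on-curve⇒f-y²≡0 x₁ y₁ on-curve) defect≡0 ⟩
      0ℚ + 0ℚ * (x₃ - x₁)                                       ≡⟨ cong (λ t → 0ℚ + t) (ℚ.*-zeroˡ (x₃ - x₁)) ⟩
      0ℚ                                                        ∎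

  secant-Chord : ∀ {x₁ y₁ x₂ y₂} → x₁ ≢ x₂ → y₁ * y₁ ≡ f x₁ → y₂ * y₂ ≡ f x₂ →
    Chord ((y₂ - y₁) * inv (x₂ - x₁)) x₁ y₁ x₂
  secant-Chord {x₁} {y₁} {x₂} {y₂} x₁≢x₂ on₁ on₂ = record
    { on-curve = on₁
    ; vieta    = sym (x∙y⁻¹≈ε⇒x≈y (c₁ l x₁ y₁) (σ₂ l x₁ x₂) ([ id , ⊥-elim ∘ Δ≢0 ]′ (*≡0⇒≡0 d (x₂ - x₁) d·Δ≡0)))
    }
    where
    l = (y₂ - y₁) * inv (x₂ - x₁)
    d = c₁ l x₁ y₁ - σ₂ l x₁ x₂
    Δ≢0 : x₂ - x₁ ≢ 0ℚ
    Δ≢0 Δ≡0 = x₁≢x₂ (sym (x∙y⁻¹≈ε⇒x≈y x₂ x₁ Δ≡0))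
    cancel : ∀ u v → u - v + v ≡ u
    cancel = RingSolver.solve-∀ ℚ-ring
    line≡y₂ : line l x₁ y₁ x₂ ≡ y₂
    line≡y₂ = trans (cong (_+ y₁) (*-inv-cancel (y₂ - y₁) Δ≢0)) (cancel y₂ y₁)
    cubic-root : ∀ u v w → u * (v - v) * w ≡ 0ℚ
    cubic-root = RingSolver.solve-∀ ℚ-ring
    d·Δ≡0 : d * (x₂ - x₁) ≡ 0ℚ
    d·Δ≡0 = begin
      d * (x₂ - x₁)                               ≡⟨ ℚ.+-identityˡ (d * (x₂ - x₁)) ⟨
      0ℚ + d * (x₂ - x₁)                          ≡⟨ cong (λ r → r + d * (x₂ - x₁)) (on-curve⇒f-y²≡0 x₁ y₁ on₁) ⟨
      (f x₁ - y₁ * y₁) + d * (x₂ - x₁)            ≡⟨ residual-at-root l x₁ y₁ x₂ x₂ (cubic-root (x₂ - x₁) x₂ (x₂ - chordX l x₁ x₂)) ⟨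
      f x₂ - line l x₁ y₁ x₂ * line l x₁ y₁ x₂    ≡⟨ cong (λ t → f x₂ - t * t) line≡y₂ ⟩
      f x₂ - y₂ * y₂                              ≡⟨ on-curve⇒f-y²≡0 x₂ y₂ on₂ ⟩
      0ℚ                                          ∎

  tangent-Chord : ∀ {x₁ y₁ y₂} → y₁ ≢ - y₂ → y₁ * y₁ ≡ f x₁ → y₂ * y₂ ≡ f x₁ →
    Chord ((⟦ + 3 ⟧ * (x₁ * x₁) + ⟦ + 2 ⟧ * ⟦ a ⟧ * x₁ + ⟦ b ⟧) * inv (⟦ + 2 ⟧ * y₁)) x₁ y₁ x₁
  tangent-Chord {x₁} {y₁} {y₂} y₁≢-y₂ on₁ on₂ = record
    { on-curve = on₁
    ; vieta    = sym (x∙y⁻¹≈ε⇒x≈y (c₁ l x₁ y₁) (σ₂ l x₁ x₁) (begin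
        c₁ l x₁ y₁ - σ₂ l x₁ x₁  ≡⟨ tangent-defect ⟦ a ⟧ ⟦ b ⟧ x₁ y₁ l ⟩
        N - l * D                ≡⟨ cong (λ t → N - t) (*-inv-cancel N D≢0) ⟩
        N - N                    ≡⟨ ℚ.+-inverseʳ N ⟩
        0ℚ                       ∎))
    }
    where
    N = ⟦ + 3 ⟧ * (x₁ * x₁) + ⟦ + 2 ⟧ * ⟦ a ⟧ * x₁ + ⟦ b ⟧
    D = ⟦ + 2 ⟧ * y₁
    l = N * inv D
    tangent-defect : ∀ A B x₁ y₁ l →
      B - ⟦ + 2 ⟧ * l * (y₁ - l * x₁) - (x₁ * x₁ + (x₁ + x₁) * (l * l - A - x₁ - x₁)) ≡
      ⟦ + 3 ⟧ * (x₁ * x₁) + ⟦ + 2 ⟧ * A * x₁ + B - l * (⟦ + 2 ⟧ * y₁)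
    tangent-defect = RingSolver.solve-∀ ℚ-ring
    y₁≢0 : y₁ ≢ 0ℚ
    y₁≢0 y₁≡0 = y₁≢-y₂ (trans y₁≡0 (cong -_ (sym y₂≡0)))
      where
      y₂≡0 : y₂ ≡ 0ℚ
      y₂≡0 = [ id , id ]′ (*≡0⇒≡0 y₂ y₂ (trans on₂ (trans (sym on₁) (cong (λ t → t * t) y₁≡0))))
    D≢0 : D ≢ 0ℚ
    D≢0 D≡0 with *≡0⇒≡0 ⟦ + 2 ⟧ y₁ D≡0
    ... | inj₁ ()
    ... | inj₂ y₁≡0 = y₁≢0 y₁≡0

module Reduction {p : ℕ} (p-prime : Prime p) (a b : ℤ) (p∣b : p ∣ ℤ.∣ b ∣) where

  open Localisation p-prime
  open ChordTangent a b

  a∈ℤ₍ₚ₎ : ⟦ a ⟧ ∈ℤ₍ₚ₎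
  a∈ℤ₍ₚ₎ = ⟦⟧∈ℤ₍ₚ₎ a

  b∈pℤ₍ₚ₎ : ⟦ b ⟧ ∈pℤ₍ₚ₎
  b∈pℤ₍ₚ₎ = ∈pℤ₍ₚ₎-intro 1ℤ b p∤1 (ℚ.*-identityʳ ⟦ b ⟧) p∣b

  on-curve-x∈⇒y∈ : ∀ {x y} → y * y ≡ f x → x ∈pℤ₍ₚ₎ → y ∈pℤ₍ₚ₎
  on-curve-x∈⇒y∈ {x} {y} on x∈ = [ id , id ]′ (pℤ₍ₚ₎-prime y y (∈pℤ₍ₚ₎-cong (sym on) f[x]∈))
    where
    x∈ℤ₍ₚ₎ : x ∈ℤ₍ₚ₎
    x∈ℤ₍ₚ₎ = ·ℤ₍ₚ₎⊆ℤ₍ₚ₎ x∈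
    xx∈ : x * x ∈pℤ₍ₚ₎
    xx∈ = ∈pℤ₍ₚ₎-*ʳ x∈ x∈ℤ₍ₚ₎
    f[x]∈ : f x ∈pℤ₍ₚ₎
    f[x]∈ = ·ℤ₍ₚ₎-+ (·ℤ₍ₚ₎-+ (∈pℤ₍ₚ₎-*ʳ xx∈ x∈ℤ₍ₚ₎) (∈pℤ₍ₚ₎-*ˡ a∈ℤ₍ₚ₎ xx∈)) (∈pℤ₍ₚ₎-*ʳ b∈pℤ₍ₚ₎ x∈ℤ₍ₚ₎)

  -- rhs is written in s, s·l, x₃ and y₃ only, so its membership follows from the hypotheses.
  s²x₁x₂∈pℤ₍ₚ₎ : ∀ {l x₁ y₁ x₂} s → Chord l x₁ y₁ x₂ →
    chordX l x₁ x₂ ∈pℤ₍ₚ₎ → - line l x₁ y₁ (chordX l x₁ x₂) ∈pℤ₍ₚ₎ →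
    s ∈ℤ₍ₚ₎ → s * l ∈ℤ₍ₚ₎ → s * s * (x₁ * x₂) ∈pℤ₍ₚ₎
  s²x₁x₂∈pℤ₍ₚ₎ {l} {x₁} {y₁} {x₂} s chord x₃∈ y₃∈ s∈ sl∈ = ∈pℤ₍ₚ₎-cong (sym expand) rhs∈
    where
    open Chord chord
    x₃ = chordX l x₁ x₂
    y₃ = - line l x₁ y₁ x₃
    rhs = s * s * ⟦ b ⟧ - ⟦ + 2 ⟧ * (s * l) * (- (s * y₃) - s * l * x₃)
          - x₃ * (s * l * (s * l) - s * s * ⟦ a ⟧ - s * s * x₃)
    split : ∀ s x₁ x₂ x₃ → s * s * (x₁ * x₂) ≡ s * s * (x₁ * x₂ + (x₁ + x₂) * x₃) - s * s * (x₁ + x₂) * x₃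
    split = RingSolver.solve-∀ ℚ-ring
    identity : ∀ A B s l x₁ y₁ x₂ →
      s * s * (B - ⟦ + 2 ⟧ * l * (y₁ - l * x₁)) - s * s * (x₁ + x₂) * (l * l - A - x₁ - x₂) ≡
      s * s * B - ⟦ + 2 ⟧ * (s * l) * (- (s * - (l * ((l * l - A - x₁ - x₂) - x₁) + y₁)) - s * l * (l * l - A - x₁ - x₂))
      - (l * l - A - x₁ - x₂) * (s * l * (s * l) - s * s * A - s * s * (l * l - A - x₁ - x₂))
    identity = RingSolver.solve-∀ ℚ-ring
    expand : s * s * (x₁ * x₂) ≡ rhs
    expand = begin
      s * s * (x₁ * x₂)                                                    ≡⟨ split s x₁ x₂ x₃ ⟩
      s * s * (x₁ * x₂ + (x₁ + x₂) * x₃) - s * s * (x₁ + x₂) * x₃          ≡⟨ cong (λ t → s * s * t - s * s * (x₁ + x₂) * x₃) vieta ⟩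
      s * s * (⟦ b ⟧ - ⟦ + 2 ⟧ * l * (y₁ - l * x₁)) - s * s * (x₁ + x₂) * x₃ ≡⟨ identity ⟦ a ⟧ ⟦ b ⟧ s l x₁ y₁ x₂ ⟩
      rhs                                                                  ∎
    ss∈ : s * s ∈ℤ₍ₚ₎
    ss∈ = ∈ℤ₍ₚ₎-* s∈ s∈
    s·intercept∈ : - (s * y₃) - s * l * x₃ ∈pℤ₍ₚ₎
    s·intercept∈ = ·ℤ₍ₚ₎-- (·ℤ₍ₚ₎-neg (∈pℤ₍ₚ₎-*ˡ s∈ y₃∈)) (∈pℤ₍ₚ₎-*ˡ sl∈ x₃∈)
    s²[x₁+x₂]∈ : s * l * (s * l) - s * s * ⟦ a ⟧ - s * s * x₃ ∈ℤ₍ₚ₎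
    s²[x₁+x₂]∈ = ·ℤ₍ₚ₎-- (·ℤ₍ₚ₎-- (∈ℤ₍ₚ₎-* sl∈ sl∈) (∈ℤ₍ₚ₎-* ss∈ a∈ℤ₍ₚ₎)) (∈ℤ₍ₚ₎-* ss∈ (·ℤ₍ₚ₎⊆ℤ₍ₚ₎ x₃∈))
    rhs∈ : rhs ∈pℤ₍ₚ₎
    rhs∈ = ·ℤ₍ₚ₎-- (·ℤ₍ₚ₎-- (∈pℤ₍ₚ₎-*ˡ ss∈ b∈pℤ₍ₚ₎) (∈pℤ₍ₚ₎-*ˡ (∈ℤ₍ₚ₎-* (⟦⟧∈ℤ₍ₚ₎ (+ 2)) sl∈) s·intercept∈))
                   (∈pℤ₍ₚ₎-*ʳ x₃∈ s²[x₁+x₂]∈)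

  chord-avoids-pℤ₍ₚ₎ : ∀ {l x₁ y₁ x₂} → Chord l x₁ y₁ x₂ →
    ¬ x₁ ∈pℤ₍ₚ₎ → ¬ x₂ ∈pℤ₍ₚ₎ → ¬ chordX l x₁ x₂ ∈pℤ₍ₚ₎
  chord-avoids-pℤ₍ₚ₎ {l} {x₁} {y₁} {x₂} chord x₁∉ x₂∉ x₃∈ =
    [ integral-slope , non-integral-slope ]′ (∈ℤ₍ₚ₎⊎inverse∈pℤ₍ₚ₎ l)
    where
    x₃ = chordX l x₁ x₂
    y₃∈ : - line l x₁ y₁ x₃ ∈pℤ₍ₚ₎
    y₃∈ = on-curve-x∈⇒y∈ (Chord⇒on-curve chord) x₃∈
    1∈ℤ₍ₚ₎ : 1ℚ ∈ℤ₍ₚ₎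
    1∈ℤ₍ₚ₎ = ⟦⟧∈ℤ₍ₚ₎ 1ℤ

    integral-slope : l ∈ℤ₍ₚ₎ → ⊥
    integral-slope l∈ = [ x₁∉ , x₂∉ ]′ (pℤ₍ₚ₎-prime x₁ x₂ (∈pℤ₍ₚ₎-cong (ℚ.*-identityˡ (x₁ * x₂)) x₁x₂∈))
      where
      x₁x₂∈ : 1ℚ * 1ℚ * (x₁ * x₂) ∈pℤ₍ₚ₎
      x₁x₂∈ = s²x₁x₂∈pℤ₍ₚ₎ 1ℚ chord x₃∈ y₃∈ 1∈ℤ₍ₚ₎ (subst _∈ℤ₍ₚ₎ (sym (ℚ.*-identityˡ l)) l∈)

    non-integral-slope : ∃ (λ s → s ∈pℤ₍ₚ₎ × s * l ≡ 1ℚ) → ⊥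
    non-integral-slope (s , s∈ , sl≡1) = 1∉pℤ₍ₚ₎ (∈pℤ₍ₚ₎-cong sum≡1 (·ℤ₍ₚ₎-+ (·ℤ₍ₚ₎-+ ssx₁∈ ssx₂∈) ss[x₃+a]∈))
      where
      s∈ℤ₍ₚ₎ : s ∈ℤ₍ₚ₎
      s∈ℤ₍ₚ₎ = ·ℤ₍ₚ₎⊆ℤ₍ₚ₎ s∈
      ssx₁x₂∈ : s * s * (x₁ * x₂) ∈pℤ₍ₚ₎
      ssx₁x₂∈ = s²x₁x₂∈pℤ₍ₚ₎ s chord x₃∈ y₃∈ s∈ℤ₍ₚ₎ (subst _∈ℤ₍ₚ₎ (sym sl≡1) 1∈ℤ₍ₚ₎)
      regroupˡ : ∀ s x₁ x₂ → s * s * (x₁ * x₂) ≡ s * s * x₁ * x₂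
      regroupˡ = RingSolver.solve-∀ ℚ-ring
      regroupʳ : ∀ s x₁ x₂ → s * s * (x₁ * x₂) ≡ x₁ * (s * s * x₂)
      regroupʳ = RingSolver.solve-∀ ℚ-ring
      ssx₁∈ : s * s * x₁ ∈pℤ₍ₚ₎
      ssx₁∈ = [ id , ⊥-elim ∘ x₂∉ ]′ (pℤ₍ₚ₎-prime (s * s * x₁) x₂ (∈pℤ₍ₚ₎-cong (regroupˡ s x₁ x₂) ssx₁x₂∈))
      ssx₂∈ : s * s * x₂ ∈pℤ₍ₚ₎
      ssx₂∈ = [ ⊥-elim ∘ x₁∉ , id ]′ (pℤ₍ₚ₎-prime x₁ (s * s * x₂) (∈pℤ₍ₚ₎-cong (regroupʳ s x₁ x₂) ssx₁x₂∈))
      ss[x₃+a]∈ : s * s * (x₃ + ⟦ a ⟧) ∈pℤ₍ₚ₎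
      ss[x₃+a]∈ = ∈pℤ₍ₚ₎-*ʳ (∈pℤ₍ₚ₎-*ʳ s∈ s∈ℤ₍ₚ₎) (·ℤ₍ₚ₎-+ (·ℤ₍ₚ₎⊆ℤ₍ₚ₎ x₃∈) a∈ℤ₍ₚ₎)
      vieta-sum : ∀ A s l x₁ x₂ →
        s * s * x₁ + s * s * x₂ + s * s * ((l * l - A - x₁ - x₂) + A) ≡ s * l * (s * l)
      vieta-sum = RingSolver.solve-∀ ℚ-ring
      sum≡1 : s * s * x₁ + s * s * x₂ + s * s * (x₃ + ⟦ a ⟧) ≡ 1ℚ
      sum≡1 = trans (vieta-sum ⟦ a ⟧ s l x₁ x₂) (trans (cong₂ _*_ sl≡1 sl≡1) (ℚ.*-identityˡ 1ℚ))

  ReducesToOrigin : Pt → Set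
  ReducesToOrigin O         = ⊥
  ReducesToOrigin (aff x _) = x ∈pℤ₍ₚ₎

  E₀ : Pt → Set
  E₀ P = OnCurve a b P × ¬ ReducesToOrigin P

  chord-E₀ : ∀ {l x₁ y₁ x₂} → Chord l x₁ y₁ x₂ → ¬ x₁ ∈pℤ₍ₚ₎ → ¬ x₂ ∈pℤ₍ₚ₎ → E₀ (chordPt a l x₁ y₁ x₂)
  chord-E₀ chord x₁∉ x₂∉ = Chord⇒on-curve chord , chord-avoids-pℤ₍ₚ₎ chord x₁∉ x₂∉

  add-E₀ : ∀ P Q → E₀ P → E₀ Q → E₀ (add a b P Q)
  add-E₀ O           Q           _  Q∈ = Q∈
  add-E₀ (aff x₁ y₁) O           P∈ _  = P∈
  add-E₀ (aff x₁ y₁) (aff x₂ y₂) (on₁ , x₁∉) (on₂ , x₂∉) with x₁ ℚ.≟ x₂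
  ... | no x₁≢x₂ = chord-E₀ (secant-Chord {x₁} {y₁} {x₂} {y₂} x₁≢x₂ on₁ on₂) x₁∉ x₂∉
  ... | yes refl with y₁ ℚ.≟ - y₂
  ...   | yes _     = tt , λ ()
  ...   | no y₁≢-y₂ = chord-E₀ (tangent-Chord {x₁} {y₁} {y₂} y₁≢-y₂ on₁ on₂) x₁∉ x₁∉

  mul-E₀ : ∀ n P → E₀ P → E₀ (mul a b n P)
  mul-E₀ zero    P _  = tt , λ ()
  mul-E₀ (suc n) P P∈ = add-E₀ P (mul a b n P) P∈ (mul-E₀ n P P∈)

  reducesToOrigin⇒p∣numerator : ∀ {Q} m e n → Rep Q m e n → ReducesToOrigin Q → p ∣ ℤ.∣ m ∣
  reducesToOrigin⇒p∣numerator m e n (1≤e , _ , _ , refl) x∈ =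
    ∈pℤ₍ₚ₎⇒p∣ (e ℤ.* e) m x∈ (*-inv-cancel ⟦ m ⟧ (⟦e*e⟧≢0 1≤e))

  p∣numerator⇒reducesToOrigin : ∀ {Q} m e n → Rep Q m e n → p ∣ ℤ.∣ m ∣ → ReducesToOrigin Q
  p∣numerator⇒reducesToOrigin m e n (1≤e , gcd[m,e]≡1 , _ , refl) p∣m =
    ∈pℤ₍ₚ₎-intro (e ℤ.* e) m (p∤* e e p∤e p∤e) (*-inv-cancel ⟦ m ⟧ (⟦e*e⟧≢0 1≤e)) p∣m
    where
    p∤e : ¬ p ∣ ℤ.∣ e ∣
    p∤e = coprime⇒¬p∣both m e gcd[m,e]≡1 p∣m

prime-factor : ∀ n → n ≢ 1 → ∃ λ p → Prime p × p ∣ n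
prime-factor zero    _   = 2 , prime[2] , (2 ∣0)
prime-factor (suc n) n≢1 with factorise (suc n)
... | record { factors = [] ; isFactorisation = ∏≡n } = ⊥-elim (n≢1 ∏≡n)
... | record { factors = p ∷ _ ; isFactorisation = ∏≡n ; factorsPrime = p-prime ∷ _ } =
  p , p-prime , subst (p ∣_) (sym ∏≡n) (m∣m*n _)

no-common-prime⇒gcd≡1 : ∀ m n → (∀ {p} → Prime p → p ∣ ℤ.∣ m ∣ → p ∣ ℤ.∣ n ∣ → ⊥) → gcd m n ≡ + 1
no-common-prime⇒gcd≡1 m n no-common with ℕ.gcd ℤ.∣ m ∣ ℤ.∣ n ∣ ℕ.≟ 1
... | yes gcd≡1 = cong +_ gcd≡1
... | no gcd≢1 with prime-factor _ gcd≢1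
...   | p , p-prime , p∣gcd =
  ⊥-elim (no-common p-prime (∣-trans p∣gcd (ℕ.gcd[m,n]∣m ℤ.∣ m ∣ ℤ.∣ n ∣))
                            (∣-trans p∣gcd (ℕ.gcd[m,n]∣n ℤ.∣ m ∣ ℤ.∣ n ∣)))

lemma6p4 : (a b : ℤ) → IsElliptic a b → (P : Pt) → OnCurve a b P →
    InfiniteOrder a b P → (m₀ e₀ n₀ : ℤ) → Rep P m₀ e₀ n₀ → gcd m₀ b ≡ + 1 →
    (k : ℕ) (m e n : ℤ) → Rep (mul a b (2 ^ k) P) m e n → gcd m b ≡ + 1
lemma6p4 a b _ P on-curve _ m₀ e₀ n₀ rep₀ coprime₀ k m e n rep =
  no-common-prime⇒gcd≡1 m b λ {p} p-prime p∣m p∣b →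
    let open Reduction p-prime a b p∣b
        open Localisation p-prime
        P∈E₀ : E₀ P
        P∈E₀ = on-curve , λ P↝O → coprime⇒¬p∣both m₀ b coprime₀ (reducesToOrigin⇒p∣numerator m₀ e₀ n₀ rep₀ P↝O) p∣b
    in proj₂ (mul-E₀ (2 ^ k) P P∈E₀) (p∣numerator⇒reducesToOrigin m e n rep p∣m)
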